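{- Let $T$ be a finite set of points on a circle and let $R\subseteq T^2$. Let $a,b,c,d,x,y,z,u\in T$ be pairwise different points appearing in this order on the circle (clockwise or counterclockwise), such that $(a,x),(b,y),(c,z),(d,u)\in R$. Define $R'=(R\setminus\{(b,y),(c,z)\})\cup\{(b,z),(c,y)\}$. Then $\mathsf{gen}(R')=\mathsf{gen}(R)$ and the number of crossings in $R'$ is strictly smaller than the number of crossings in $R$.
   Context: For a finite set $T$ of points on a circle and a relation $R\subseteq T^2$, $\mathsf{gen}(R)\subseteq T^2$ is defined by: $(s,t)\in\mathsf{gen}(R)$ iff for every partition of the circle into two disjoint arcs $X_s,X_t$ with $s\in X_s$ and $t\in X_t$, there exist $s'\in X_s$ and $t'\in X_t$ with $(s',t')\in R$ (arcs may be open or closed at either end). Pairs $(p,q)\in R$ with $p\neq q$ are viewed as chords with endpoints $p,q$. Two chords $\{p,p'\},\{q,q'\}$ cross if their endpoints are all distinct and $p,q,p',q'$ occur in this order on the circle (clockwise or counterclockwise). A crossing of $R$ is a pair of crossing chords in $R$. -}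

module Defs where

open import Data.Nat using (ℕ; _+_; _≤_; _<_; _/_)
import Data.Nat as ℕ
open import Data.Fin using (Fin; toℕ; _≟_)
import Data.Fin as Fin
open import Data.Bool using (Bool; true; false; _∧_; _∨_; not; if_then_else_)
open import Data.List using (List; []; _∷_; _++_; drop; take; length; reverse; upTo; map; allFin)
open import Data.Nat.ListAction using (sum)
open import Data.List.Relation.Unary.Linked using (Linked; linked?)
open import Data.List.Relation.Unary.Any using (Any; any?)
open import Data.Product using (Σ; ∃; _×_; _,_)
open import Data.Sum using (_⊎_)
open import Relation.Nullary using (¬_; Dec; _⊎-dec_)
open import Relation.Nullary.Decidable using (⌊_⌋; isYes)
open import Relation.Binary.PropositionalEquality using (_≡_)
open import Function.Bundles using (_⇔_)

-- Model: the finite point set T on the circle is Fin n, the points listed in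
-- clockwise order 0 , 1 , ... , n-1 .

Rel₂ : ℕ → Set
Rel₂ n = Fin n → Fin n → Bool

rotate : {A : Set} → ℕ → List A → List A
rotate k xs = drop k xs ++ take k xs

-- xs occurs in this (clockwise) order on the circle, all points different:
-- some rotation of xs is strictly increasing.
ClockwiseOrder : {n : ℕ} → List (Fin n) → Set
ClockwiseOrder xs = Any (λ k → Linked Fin._<_ (rotate k xs)) (upTo (length xs))

CyclicOrder : {n : ℕ} → List (Fin n) → Set
CyclicOrder xs = ClockwiseOrder xs ⊎ ClockwiseOrder (reverse xs)

cyclicOrder? : {n : ℕ} → (xs : List (Fin n)) → Dec (CyclicOrder xs)
cyclicOrder? xs =
  any? (λ k → linked? Fin._<?_ (rotate k xs)) (upTo (length xs))
  ⊎-dec any? (λ k → linked? Fin._<?_ (rotate k (reverse xs))) (upTo (length (reverse xs)))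

-- chords {p,p'} and {q,q'} cross: endpoints all distinct and p,q,p',q'
-- occur in this order on the circle (either orientation).  Distinctness is
-- implied by the strict increase in CyclicOrder.
Cross : {n : ℕ} → Fin n → Fin n → Fin n → Fin n → Set
Cross p p' q q' = CyclicOrder (p ∷ q ∷ p' ∷ q' ∷ [])

cross? : {n : ℕ} → (p p' q q' : Fin n) → Dec (Cross p p' q q')
cross? p p' q q' = cyclicOrder? (p ∷ q ∷ p' ∷ q' ∷ [])

-- Arcs of the circle, restricted to T = Fin n: the arc starting at point i
-- and containing k consecutive points (clockwise), k ≤ n.
InArc : {n : ℕ} → Fin n → ℕ → Fin n → Set
InArc {n} i k p = (toℕ i ≤ toℕ p × toℕ p < toℕ i + k) ⊎ (toℕ p + n < toℕ i + k)

-- gen(R): (s,t) ∈ gen(R) iff for every partition of the circle into two arcs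
-- X_s ∋ s, X_t ∋ t (X_t is the complement of X_s), some pair of R goes from
-- X_s to X_t.
Gen : {n : ℕ} → Rel₂ n → Fin n → Fin n → Set
Gen {n} R s t =
  (i : Fin n) (k : ℕ) → k ≤ n → InArc i k s → ¬ InArc i k t →
  ∃ λ s' → ∃ λ t' → InArc i k s' × ¬ InArc i k t' × R s' t' ≡ true

countFin : {n : ℕ} → (Fin n → ℕ) → ℕ
countFin {n} f = sum (map f (allFin n))

orderedCrossings : {n : ℕ} → Rel₂ n → ℕ
orderedCrossings R =
  countFin λ p → countFin λ p' → countFin λ q → countFin λ q' →
    if R p p' ∧ R q q' ∧ isYes (cross? p p' q q') then 1 else 0

-- number of crossings = number of unordered pairs {e₁ , e₂} of crossing
-- chords of R (each is counted twice above, crossing chords being distinct)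
crossings : {n : ℕ} → Rel₂ n → ℕ
crossings R = orderedCrossings R / 2

isPair : {n : ℕ} → Fin n → Fin n → Fin n → Fin n → Bool
isPair u v p q = ⌊ p ≟ u ⌋ ∧ ⌊ q ≟ v ⌋

swapPairs : {n : ℕ} → Rel₂ n → (b c y z : Fin n) → Rel₂ n
swapPairs R b c y z p q =
  (R p q ∧ not (isPair b y p q) ∧ not (isPair c z p q))
  ∨ isPair b z p q ∨ isPair c y p q

-- An arc of the circle meets the cyclically ordered points a, b, c, d, x, y, z, u in a cyclic
-- interval, so it never separates two interleaved pairs such as {b, y} and {c, z}.  Hence if a
-- new pair (b, z) or (c, y) leaves an arc, so does (b, y) or (c, z); and if an old pair, say
-- (b, y), leaves an arc that neither new pair leaves, the arc contains a and misses x, so the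
-- surviving pair (a, x) leaves it.  Thus gen is unchanged.
--
-- For the crossings, R is the kept pairs plus the chords by and cz, while R' is at most the kept
-- pairs plus bz and cy.  Of these four chords only by and cz cross, and any chord crosses at most
-- as many of bz, cy as of by, cz.  Expanding the count of ordered crossing pairs as a bilinear
-- form, it therefore drops by at least 2.  Whether two chords cross depends only on the relative
-- order of their endpoints, so these facts about four or six points are checked on Fin 4 and
-- Fin 6 after replacing each point by its rank.

module Submission where

open import Defs
open import Data.Nat using (ℕ; _<_)
open import Data.Fin using (Fin)
open import Data.List using (List; []; _∷_)
open import Data.Bool using (true)
open import Data.Product using (_×_)
open import Relation.Binary.PropositionalEquality using (_≡_)
open import Function.Bundles using (_⇔_)

open import Data.Bool using (Bool; false; _∧_; _∨_; not; if_then_else_)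
open import Data.Bool.Properties using (∨-zeroʳ)
open import Data.Fin using (toℕ)
import Data.Fin as Fin
import Data.Fin.Properties as Fin
open import Data.Fin.Properties using (all?)
open import Data.List using (_++_; length; map; upTo; reverse; drop; take; tabulate)
open import Data.List.Properties
  using (++-identityʳ; length-++; take++drop≡id; reverse-injective; map-++; drop-map; take-map;
         length-map; reverse-map; map-tabulate)
open import Data.List.Membership.Propositional using (_∈_; lose)
open import Data.List.Membership.Propositional.Properties using (∈-upTo⁺)
open import Data.List.Relation.Binary.Sublist.Propositional using (_⊆_; []; _∷_; _∷ʳ_)
open import Data.List.Relation.Binary.Sublist.Propositional.Properties using (All-resp-⊆; ++⁺; reverse⁺)
open import Data.List.Relation.Unary.All using (All; []; _∷_)
import Data.List.Relation.Unary.All as All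
import Data.List.Relation.Unary.All.Properties as All
open import Data.List.Relation.Unary.AllPairs using (AllPairs; []; _∷_)
open import Data.List.Relation.Unary.Any using (Any; here; there; satisfied)
import Data.List.Relation.Unary.Any as Any
import Data.List.Relation.Unary.Any.Properties as Any
open import Data.List.Relation.Unary.Linked using (Linked; []; [-]; _∷_)
open import Data.List.Relation.Unary.Linked.Properties using (AllPairs⇒Linked; Linked⇒AllPairs)
open import Data.Nat using (zero; suc; _+_; _*_; _≤_; _/_; NonZero; z≤n; s≤s)
import Data.Nat.Properties as ℕ
open import Algebra.Properties.Semiring.Sum ℕ.+-*-semiring
  using (sum; sum-cong-≗; ∑-distrib-+; *-distribˡ-sum; sum-remove; sum-replicate-zero)
open import Data.Nat.DivMod using (_mod_; m<n⇒m%n≡m; /-monoˡ-≤; +-distrib-/-∣ʳ)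
open import Data.Nat.Divisibility using (∣-refl)
open import Data.Nat.ListAction using () renaming (sum to sumₗ)
open import Data.Product using (∃; ∃₂; _,_; proj₁; proj₂)
open import Data.Sum using (_⊎_; inj₁; inj₂)
import Data.Sum as Sum
open import Function using (_∘_; _∘′_)
open import Function.Bundles using (mk⇔; Equivalence)
open import Level using (Level)
open import Relation.Binary.Core using (Rel)
open import Relation.Binary.Definitions using (Transitive)
open import Relation.Binary.PropositionalEquality
  using (_≢_; refl; sym; trans; cong; cong₂; subst; subst₂; module ≡-Reasoning)
open import Relation.Nullary using (¬_; Dec; yes; no; does; contradiction; _×-dec_; _⊎-dec_)
open import Relation.Nullary.Decidable
  using (isYes; isYes≗does; does-⇔; dec-true; dec-false; decidable-stable; from-yes; _→-dec_)
open import Relation.Nullary.Reflects using (Reflects; ofʸ; ofⁿ)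
open import Relation.Unary using (Pred; Decidable)

private variable
  a ℓ : Level
  A : Set a
  m n : ℕ

AllPairs-resp-⊇ : ∀ {R : Rel A ℓ} {xs ys} → ys ⊆ xs → AllPairs R xs → AllPairs R ys
AllPairs-resp-⊇ []          []         = []
AllPairs-resp-⊇ (_ ∷ʳ τ)    (_ ∷ rxs)  = AllPairs-resp-⊇ τ rxs
AllPairs-resp-⊇ (refl ∷ τ)  (rx ∷ rxs) = All-resp-⊆ τ rx ∷ AllPairs-resp-⊇ τ rxs

Linked-resp-⊇ : ∀ {R : Rel A ℓ} → Transitive R → ∀ {xs ys} → ys ⊆ xs → Linked R xs → Linked R ys
Linked-resp-⊇ R-trans τ = AllPairs⇒Linked ∘′ AllPairs-resp-⊇ τ ∘′ Linked⇒AllPairs R-trans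

⊆-++-split : ∀ (xs : List A) {ys zs} → zs ⊆ xs ++ ys →
             ∃₂ λ xs′ ys′ → zs ≡ xs′ ++ ys′ × xs′ ⊆ xs × ys′ ⊆ ys
⊆-++-split []       τ = [] , _ , refl , [] , τ
⊆-++-split (x ∷ xs) (_ ∷ʳ τ)   with xs′ , ys′ , refl , σ , ρ ← ⊆-++-split xs τ =
  xs′ , ys′ , refl , x ∷ʳ σ , ρ
⊆-++-split (x ∷ xs) (refl ∷ τ) with xs′ , ys′ , refl , σ , ρ ← ⊆-++-split xs τ =
  x ∷ xs′ , ys′ , refl , refl ∷ σ , ρ

drop-++ : ∀ (xs : List A) {ys} → drop (length xs) (xs ++ ys) ≡ ys
drop-++ []       = refl
drop-++ (_ ∷ xs) = drop-++ xs

take-++ : ∀ (xs : List A) {ys} → take (length xs) (xs ++ ys) ≡ xs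
take-++ []       = refl
take-++ (x ∷ xs) = cong (x ∷_) (take-++ xs)

rotate-++ : ∀ (xs ys : List A) → rotate (length xs) (xs ++ ys) ≡ ys ++ xs
rotate-++ xs ys = cong₂ _++_ (drop-++ xs) (take-++ xs)

rotation⇒clockwiseOrder : (xs ys : List (Fin n)) → xs ++ ys ≢ [] →
                          Linked Fin._<_ (ys ++ xs) → ClockwiseOrder (xs ++ ys)
rotation⇒clockwiseOrder []       []       ne _ = contradiction refl ne
rotation⇒clockwiseOrder (x ∷ xs) []       _  L =
  here (subst (Linked Fin._<_) (sym (trans (++-identityʳ _) (++-identityʳ _))) L)
rotation⇒clockwiseOrder xs       (y ∷ ys) _  L =
  lose (∈-upTo⁺ length<) (subst (Linked Fin._<_) (sym (rotate-++ xs (y ∷ ys))) L)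
  where
  length< : length xs < length (xs ++ y ∷ ys)
  length< = subst (length xs <_) (sym (length-++ xs)) (ℕ.m<m+n (length xs) (s≤s z≤n))

clockwiseOrder-⊆ : {xs ys : List (Fin n)} → ys ⊆ xs → ys ≢ [] →
                   ClockwiseOrder xs → ClockwiseOrder ys
clockwiseOrder-⊆ {xs = xs} τ ne cw
  with k , L ← satisfied cw
  with ys₁ , ys₂ , refl , σ , ρ ← ⊆-++-split (take k xs) (subst (_ ⊆_) (sym (take++drop≡id k xs)) τ)
  = rotation⇒clockwiseOrder ys₁ ys₂ ne (Linked-resp-⊇ Fin.<-trans (++⁺ ρ σ) L)

cyclicOrder-⊆ : {xs ys : List (Fin n)} → ys ⊆ xs → ys ≢ [] → CyclicOrder xs → CyclicOrder ys
cyclicOrder-⊆ τ ne =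
  Sum.map (clockwiseOrder-⊆ τ ne) (clockwiseOrder-⊆ (reverse⁺ τ) (ne ∘ reverse-injective))

cyclicOrder⇒≢ : {p q : Fin n} → CyclicOrder (p ∷ q ∷ []) → p ≢ q
cyclicOrder⇒≢ (inj₁ (here (p<q ∷ [-])))         refl = Fin.<-irrefl refl p<q
cyclicOrder⇒≢ (inj₁ (there (here (q<p ∷ [-])))) refl = Fin.<-irrefl refl q<p
cyclicOrder⇒≢ (inj₂ (here (q<p ∷ [-])))         refl = Fin.<-irrefl refl q<p
cyclicOrder⇒≢ (inj₂ (there (here (p<q ∷ [-])))) refl = Fin.<-irrefl refl p<q

-- Arcs

Convex : (Fin n → Set) → Set
Convex P = ∀ {p q r} → p Fin.< q → q Fin.< r → P p → P r → P q

-- Cut open at 0, an arc of the circle is an interval of Fin n or the complement of one.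
IsArc : (Fin n → Set) → Set
IsArc P = Convex P ⊎ Convex (¬_ ∘ P)

inArc? : (i : Fin n) (k : ℕ) → Decidable (InArc i k)
inArc? {n} i k p = (toℕ i ℕ.≤? toℕ p ×-dec toℕ p ℕ.<? toℕ i + k) ⊎-dec toℕ p + n ℕ.<? toℕ i + k

inArc-isArc : (i : Fin n) (k : ℕ) → IsArc (InArc i k)
inArc-isArc {n} i k with toℕ i + k ℕ.≤? n
... | yes i+k≤n = inj₁ convex
  where
  inside : ∀ {p} → InArc i k p → toℕ i ≤ toℕ p × toℕ p < toℕ i + k
  inside (inj₁ p∈) = p∈
  inside {p} (inj₂ p+n<i+k) = contradiction (ℕ.<-≤-trans p+n<i+k i+k≤n) (ℕ.m+n≮n (toℕ p) n)
  convex : Convex (InArc i k)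
  convex p<q q<r p∈ r∈ =
    inj₁ (ℕ.≤-trans (proj₁ (inside p∈)) (ℕ.<⇒≤ p<q) , ℕ.<-trans q<r (proj₂ (inside r∈)))
... | no i+k≰n = inj₂ convex
  where
  convex : Convex (¬_ ∘ InArc i k)
  convex {r = r} p<q q<r p∉ r∉ (inj₁ (i≤q , _)) =
    r∉ (inj₁ (ℕ.≤-trans i≤q (ℕ.<⇒≤ q<r) , ℕ.<-trans (Fin.toℕ<n r) (ℕ.≰⇒> i+k≰n)))
  convex p<q q<r p∉ r∉ (inj₂ q+n<i+k) = p∉ (inj₂ (ℕ.<-trans (ℕ.+-monoˡ-< n p<q) q+n<i+k))

Alternating : (Fin n → Set) → Fin n → Fin n → Fin n → Fin n → Set
Alternating P w x y z = (P w × ¬ P x × P y × ¬ P z) ⊎ (¬ P w × P x × ¬ P y × P z)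

module _ {P : Fin n → Set} where

  alternating-rotate : ∀ {w x y z} → Alternating P w x y z → Alternating P x y z w
  alternating-rotate (inj₁ (pw , px , py , pz)) = inj₂ (px , py , pz , pw)
  alternating-rotate (inj₂ (pw , px , py , pz)) = inj₁ (px , py , pz , pw)

  alternating-reverse : ∀ {w x y z} → Alternating P w x y z → Alternating P z y x w
  alternating-reverse (inj₁ (pw , px , py , pz)) = inj₂ (pz , py , px , pw)
  alternating-reverse (inj₂ (pw , px , py , pz)) = inj₁ (pz , py , px , pw)

  arc-increasing-¬alternating : ∀ {w x y z} → IsArc P →
    w Fin.< x → x Fin.< y → y Fin.< z → ¬ Alternating P w x y z
  arc-increasing-¬alternating (inj₁ cvx) w<x x<y _ (inj₁ (pw , ¬px , py , _)) = ¬px (cvx w<x x<y pw py)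
  arc-increasing-¬alternating (inj₁ cvx) _ x<y y<z (inj₂ (_ , px , ¬py , pz)) = ¬py (cvx x<y y<z px pz)
  arc-increasing-¬alternating (inj₂ cvx) _ x<y y<z (inj₁ (_ , ¬px , py , ¬pz)) = cvx x<y y<z ¬px ¬pz py
  arc-increasing-¬alternating (inj₂ cvx) w<x x<y _ (inj₂ (¬pw , px , ¬py , _)) = cvx w<x x<y ¬pw ¬py px

  arc-¬alternating : ∀ {w x y z} → IsArc P →
    CyclicOrder (w ∷ x ∷ y ∷ z ∷ []) → ¬ Alternating P w x y z
  arc-¬alternating arc (inj₁ (here (h₁ ∷ h₂ ∷ h₃ ∷ [-]))) =
    arc-increasing-¬alternating arc h₁ h₂ h₃
  arc-¬alternating arc (inj₁ (there (here (h₁ ∷ h₂ ∷ h₃ ∷ [-])))) =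
    arc-increasing-¬alternating arc h₁ h₂ h₃ ∘ alternating-rotate
  arc-¬alternating arc (inj₁ (there (there (here (h₁ ∷ h₂ ∷ h₃ ∷ [-]))))) =
    arc-increasing-¬alternating arc h₁ h₂ h₃ ∘ alternating-rotate ∘ alternating-rotate
  arc-¬alternating arc (inj₁ (there (there (there (here (h₁ ∷ h₂ ∷ h₃ ∷ [-])))))) =
    arc-increasing-¬alternating arc h₁ h₂ h₃ ∘ alternating-rotate ∘ alternating-rotate ∘ alternating-rotate
  arc-¬alternating arc (inj₂ (here (h₁ ∷ h₂ ∷ h₃ ∷ [-]))) =
    arc-increasing-¬alternating arc h₁ h₂ h₃ ∘ alternating-reverse
  arc-¬alternating arc (inj₂ (there (here (h₁ ∷ h₂ ∷ h₃ ∷ [-])))) =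
    arc-increasing-¬alternating arc h₁ h₂ h₃ ∘ alternating-rotate ∘ alternating-reverse
  arc-¬alternating arc (inj₂ (there (there (here (h₁ ∷ h₂ ∷ h₃ ∷ [-]))))) =
    arc-increasing-¬alternating arc h₁ h₂ h₃ ∘ alternating-rotate ∘ alternating-rotate ∘ alternating-reverse
  arc-¬alternating arc (inj₂ (there (there (there (here (h₁ ∷ h₂ ∷ h₃ ∷ [-])))))) =
    arc-increasing-¬alternating arc h₁ h₂ h₃ ∘ alternating-rotate ∘ alternating-rotate ∘ alternating-rotate ∘ alternating-reverse

isPair-reflects : (u v p q : Fin n) → Reflects (p ≡ u × q ≡ v) (isPair u v p q)
isPair-reflects u v p q with p Fin.≟ u | q Fin.≟ v
... | yes refl | yes refl = ofʸ (refl , refl)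
... | yes _    | no q≢v   = ofⁿ (q≢v ∘ proj₂)
... | no p≢u   | _        = ofⁿ (p≢u ∘ proj₁)

module _ (R : Rel₂ n) (b c y z : Fin n) where

  swapPairs-bz : swapPairs R b c y z b z ≡ true
  swapPairs-bz with isPair b z b z | isPair-reflects b z b z
  ... | true  | _      = ∨-zeroʳ _
  ... | false | ofⁿ ¬e = contradiction (refl , refl) ¬e

  swapPairs-cy : swapPairs R b c y z c y ≡ true
  swapPairs-cy with isPair c y c y | isPair-reflects c y c y
  ... | true  | _      = trans (cong (kept ∨_) (∨-zeroʳ (isPair b z c y))) (∨-zeroʳ kept)
    where kept = R c y ∧ not (isPair b y c y) ∧ not (isPair c z c y)
  ... | false | ofⁿ ¬e = contradiction (refl , refl) ¬e

  swapPairs-kept : ∀ {p q} → R p q ≡ true → ¬ (p ≡ b × q ≡ y) → ¬ (p ≡ c × q ≡ z) →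
                   swapPairs R b c y z p q ≡ true
  swapPairs-kept {p} {q} Rpq ¬by ¬cz
    with isPair b y p q | isPair-reflects b y p q | isPair c z p q | isPair-reflects c z p q
  ... | true  | ofʸ by | _     | _      = contradiction by ¬by
  ... | false | _      | true  | ofʸ cz = contradiction cz ¬cz
  ... | false | _      | false | _      rewrite Rpq = refl

  swapPairs⁻ : ∀ {p q} → swapPairs R b c y z p q ≡ true →
               R p q ≡ true ⊎ (p ≡ b × q ≡ z) ⊎ (p ≡ c × q ≡ y)
  swapPairs⁻ {p} {q} e
    with isPair b z p q | isPair-reflects b z p q | isPair c y p q | isPair-reflects c y p q
  ... | true  | ofʸ bz | _     | _      = inj₂ (inj₁ bz)
  ... | false | _      | true  | ofʸ cy = inj₂ (inj₂ cy)
  ... | false | _      | false | _      with R p q | e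
  ...   | true  | _  = inj₁ refl
  ...   | false | ()

  swapPairs⁺ : ∀ {p q} → R p q ≡ true →
               swapPairs R b c y z p q ≡ true ⊎ (p ≡ b × q ≡ y) ⊎ (p ≡ c × q ≡ z)
  swapPairs⁺ {p} {q} Rpq with p Fin.≟ b ×-dec q Fin.≟ y | p Fin.≟ c ×-dec q Fin.≟ z
  ... | yes by  | _      = inj₂ (inj₁ by)
  ... | no _    | yes cz = inj₂ (inj₂ cz)
  ... | no ¬by  | no ¬cz = inj₁ (swapPairs-kept Rpq ¬by ¬cz)

Leaves : (Fin n → Set) → Rel₂ n → Set
Leaves X Q = ∃ λ s → ∃ λ t → X s × ¬ X t × Q s t ≡ true

module _ (R : Rel₂ n) {a b c d x y z u : Fin n}
         (order : CyclicOrder (a ∷ b ∷ c ∷ d ∷ x ∷ y ∷ z ∷ u ∷ []))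
         (Rax : R a x ≡ true) (Rby : R b y ≡ true) (Rcz : R c z ≡ true) (Rdu : R d u ≡ true) where

  private
    R' : Rel₂ n
    R' = swapPairs R b c y z

    bcyz : CyclicOrder (b ∷ c ∷ y ∷ z ∷ [])
    bcyz = cyclicOrder-⊆ (a ∷ʳ refl ∷ refl ∷ d ∷ʳ x ∷ʳ refl ∷ refl ∷ u ∷ʳ []) (λ ()) order
    abcz : CyclicOrder (a ∷ b ∷ c ∷ z ∷ [])
    abcz = cyclicOrder-⊆ (refl ∷ refl ∷ refl ∷ d ∷ʳ x ∷ʳ y ∷ʳ refl ∷ u ∷ʳ []) (λ ()) order
    cxyz : CyclicOrder (c ∷ x ∷ y ∷ z ∷ [])
    cxyz = cyclicOrder-⊆ (a ∷ʳ b ∷ʳ refl ∷ d ∷ʳ refl ∷ refl ∷ refl ∷ u ∷ʳ []) (λ ()) order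
    cdyz : CyclicOrder (c ∷ d ∷ y ∷ z ∷ [])
    cdyz = cyclicOrder-⊆ (a ∷ʳ b ∷ʳ refl ∷ refl ∷ x ∷ʳ refl ∷ refl ∷ u ∷ʳ []) (λ ()) order
    byzu : CyclicOrder (b ∷ y ∷ z ∷ u ∷ [])
    byzu = cyclicOrder-⊆ (a ∷ʳ refl ∷ c ∷ʳ d ∷ʳ x ∷ʳ refl ∷ refl ∷ refl ∷ []) (λ ()) order
    a≢b : a ≢ b
    a≢b = cyclicOrder⇒≢ (cyclicOrder-⊆ (refl ∷ refl ∷ c ∷ʳ d ∷ʳ x ∷ʳ y ∷ʳ z ∷ʳ u ∷ʳ []) (λ ()) order)
    a≢c : a ≢ c
    a≢c = cyclicOrder⇒≢ (cyclicOrder-⊆ (refl ∷ b ∷ʳ refl ∷ d ∷ʳ x ∷ʳ y ∷ʳ z ∷ʳ u ∷ʳ []) (λ ()) order)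
    b≢d : b ≢ d
    b≢d = cyclicOrder⇒≢ (cyclicOrder-⊆ (a ∷ʳ refl ∷ c ∷ʳ refl ∷ x ∷ʳ y ∷ʳ z ∷ʳ u ∷ʳ []) (λ ()) order)
    c≢d : c ≢ d
    c≢d = cyclicOrder⇒≢ (cyclicOrder-⊆ (a ∷ʳ b ∷ʳ refl ∷ refl ∷ x ∷ʳ y ∷ʳ z ∷ʳ u ∷ʳ []) (λ ()) order)

  module _ {X : Fin n → Set} (X? : Decidable X) (arc : IsArc X) where

    private
      ¬alt : ∀ {w x y z} → CyclicOrder (w ∷ x ∷ y ∷ z ∷ []) → ¬ Alternating X w x y z
      ¬alt = arc-¬alternating arc

    leaves-from-bz : X b → ¬ X z → Leaves X R
    leaves-from-bz Xb ¬Xz with X? y | X? c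
    ... | no ¬Xy | _      = b , y , Xb , ¬Xy , Rby
    ... | yes _  | yes Xc = c , z , Xc , ¬Xz , Rcz
    ... | yes Xy | no ¬Xc = contradiction (inj₁ (Xb , ¬Xc , Xy , ¬Xz)) (¬alt bcyz)

    leaves-from-cy : X c → ¬ X y → Leaves X R
    leaves-from-cy Xc ¬Xy with X? z | X? b
    ... | no ¬Xz | _      = c , z , Xc , ¬Xz , Rcz
    ... | yes _  | yes Xb = b , y , Xb , ¬Xy , Rby
    ... | yes Xz | no ¬Xb = contradiction (inj₂ (¬Xb , Xc , ¬Xy , Xz)) (¬alt bcyz)

    leaves-from-by : X b → ¬ X y → Leaves X R'
    leaves-from-by Xb ¬Xy with X? c | X? z
    ... | yes Xc | _      = c , y , Xc , ¬Xy , swapPairs-cy R b c y z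
    ... | no _   | no ¬Xz = b , z , Xb , ¬Xz , swapPairs-bz R b c y z
    ... | no ¬Xc | yes Xz =
      a , x , Xa , ¬Xx , swapPairs-kept R b c y z Rax (a≢b ∘ proj₁) (a≢c ∘ proj₁)
      where
      Xa : X a
      Xa = decidable-stable (X? a) λ ¬Xa → ¬alt abcz (inj₂ (¬Xa , Xb , ¬Xc , Xz))
      ¬Xx : ¬ X x
      ¬Xx Xx = ¬alt cxyz (inj₂ (¬Xc , Xx , ¬Xy , Xz))

    leaves-from-cz : X c → ¬ X z → Leaves X R'
    leaves-from-cz Xc ¬Xz with X? b | X? y
    ... | yes Xb | _      = b , z , Xb , ¬Xz , swapPairs-bz R b c y z
    ... | no _   | no ¬Xy = c , y , Xc , ¬Xy , swapPairs-cy R b c y z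
    ... | no ¬Xb | yes Xy =
      d , u , Xd , ¬Xu , swapPairs-kept R b c y z Rdu (b≢d ∘ sym ∘ proj₁) (c≢d ∘ sym ∘ proj₁)
      where
      Xd : X d
      Xd = decidable-stable (X? d) λ ¬Xd → ¬alt cdyz (inj₁ (Xc , ¬Xd , Xy , ¬Xz))
      ¬Xu : ¬ X u
      ¬Xu Xu = ¬alt byzu (inj₂ (¬Xb , Xy , ¬Xz , Xu))

    leaves-swapPairs⁻ : Leaves X R' → Leaves X R
    leaves-swapPairs⁻ (s , t , Xs , ¬Xt , R'st) with swapPairs⁻ R b c y z R'st
    ... | inj₁ Rst                 = s , t , Xs , ¬Xt , Rst
    ... | inj₂ (inj₁ (refl , refl)) = leaves-from-bz Xs ¬Xt
    ... | inj₂ (inj₂ (refl , refl)) = leaves-from-cy Xs ¬Xt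

    leaves-swapPairs⁺ : Leaves X R → Leaves X R'
    leaves-swapPairs⁺ (s , t , Xs , ¬Xt , Rst) with swapPairs⁺ R b c y z Rst
    ... | inj₁ R'st                = s , t , Xs , ¬Xt , R'st
    ... | inj₂ (inj₁ (refl , refl)) = leaves-from-by Xs ¬Xt
    ... | inj₂ (inj₂ (refl , refl)) = leaves-from-cz Xs ¬Xt

  swapPairs-gen⇔ : (s t : Fin n) → Gen (swapPairs R b c y z) s t ⇔ Gen R s t
  swapPairs-gen⇔ s t = mk⇔
    (λ G i k k≤n s∈ t∉ → leaves-swapPairs⁻ (inArc? i k) (inArc-isArc i k) (G i k k≤n s∈ t∉))
    (λ G i k k≤n s∈ t∉ → leaves-swapPairs⁺ (inArc? i k) (inArc-isArc i k) (G i k k≤n s∈ t∉))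

-- Crossings depend only on the order of the endpoints

𝟙 : Bool → ℕ
𝟙 b = if b then 1 else 0

χ : Fin n → Fin n → Fin n → Fin n → ℕ
χ p p' q q' = 𝟙 (isYes (cross? p p' q q'))

χ-resp-⇔ : {p p' q q' : Fin n} {s s' t t' : Fin m} →
           Cross p p' q q' ⇔ Cross s s' t t' → χ p p' q q' ≡ χ s s' t t'
χ-resp-⇔ {p = p} {p'} {q} {q'} {s} {s'} {t} {t'} cross⇔ = cong 𝟙 (begin
  isYes (cross? p p' q q') ≡⟨ isYes≗does _ ⟩
  does (cross? p p' q q')  ≡⟨ does-⇔ cross⇔ (cross? p p' q q') (cross? s s' t t') ⟩
  does (cross? s s' t t')  ≡⟨ isYes≗does _ ⟨
  isYes (cross? s s' t t') ∎)
  where open ≡-Reasoning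

Cross⇒χ≡1 : {p p' q q' : Fin n} → Cross p p' q q' → χ p p' q q' ≡ 1
Cross⇒χ≡1 {p = p} {p'} {q} {q'} cross =
  cong 𝟙 (trans (isYes≗does _) (dec-true (cross? p p' q q') cross))

¬Cross⇒χ≡0 : {p p' q q' : Fin n} → ¬ Cross p p' q q' → χ p p' q q' ≡ 0
¬Cross⇒χ≡0 {p = p} {p'} {q} {q'} ¬cross =
  cong 𝟙 (trans (isYes≗does _) (dec-false (cross? p p' q q') ¬cross))

module _ {P : Pred (Fin n) ℓ} (f : Fin n → Fin m)
         (embedding : ∀ {u v} → P u → P v → u Fin.< v ⇔ f u Fin.< f v) where

  linked-map⁺ : ∀ {xs} → All P xs → Linked Fin._<_ xs → Linked Fin._<_ (map f xs)
  linked-map⁺ _ []  = []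
  linked-map⁺ _ [-] = [-]
  linked-map⁺ (Px ∷ Py ∷ Pxs) (x<y ∷ L) =
    Equivalence.to (embedding Px Py) x<y ∷ linked-map⁺ (Py ∷ Pxs) L

  linked-map⁻ : ∀ {xs} → All P xs → Linked Fin._<_ (map f xs) → Linked Fin._<_ xs
  linked-map⁻ []       _ = []
  linked-map⁻ (_ ∷ []) _ = [-]
  linked-map⁻ (Px ∷ Py ∷ Pxs) (fx<fy ∷ L) =
    Equivalence.from (embedding Px Py) fx<fy ∷ linked-map⁻ (Py ∷ Pxs) L

  clockwiseOrder-map : ∀ {xs} → All P xs → ClockwiseOrder xs ⇔ ClockwiseOrder (map f xs)
  clockwiseOrder-map {xs} Pxs = mk⇔
    (subst (λ l → Any (λ k → Linked Fin._<_ (rotate k (map f xs))) (upTo l)) (sym (length-map f xs))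
      ∘ Any.map (λ {k} → subst (Linked Fin._<_) (sym (rotate-map k)) ∘ linked-map⁺ (rotate-All k)))
    (Any.map (λ {k} → linked-map⁻ (rotate-All k) ∘ subst (Linked Fin._<_) (rotate-map k))
      ∘ subst (λ l → Any (λ k → Linked Fin._<_ (rotate k (map f xs))) (upTo l)) (length-map f xs))
    where
    rotate-map : ∀ k → rotate k (map f xs) ≡ map f (rotate k xs)
    rotate-map k = trans (cong₂ _++_ (drop-map k xs) (take-map k xs)) (sym (map-++ f (drop k xs) (take k xs)))
    rotate-All : ∀ k → All P (rotate k xs)
    rotate-All k = All.++⁺ (All.drop⁺ k Pxs) (All.take⁺ k Pxs)

  cyclicOrder-map : ∀ {xs} → All P xs → CyclicOrder xs ⇔ CyclicOrder (map f xs)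
  cyclicOrder-map {xs} Pxs = mk⇔
    (Sum.map (Equivalence.to (clockwiseOrder-map Pxs))
             (reverse-map⁺ ∘ Equivalence.to (clockwiseOrder-map reverse-All)))
    (Sum.map (Equivalence.from (clockwiseOrder-map Pxs))
             (Equivalence.from (clockwiseOrder-map reverse-All) ∘ reverse-map⁻))
    where
    reverse-All : All P (reverse xs)
    reverse-All = All.tabulate (All.lookup Pxs ∘ Any.reverse⁻)
    reverse-map⁺ : ClockwiseOrder (map f (reverse xs)) → ClockwiseOrder (reverse (map f xs))
    reverse-map⁺ = subst ClockwiseOrder (reverse-map f xs)
    reverse-map⁻ : ClockwiseOrder (reverse (map f xs)) → ClockwiseOrder (map f (reverse xs))
    reverse-map⁻ = subst ClockwiseOrder (sym (reverse-map f xs))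

below : List (Fin n) → Fin n → ℕ
below []      x = 0
below (v ∷ V) x = 𝟙 (does (v Fin.<? x)) + below V x

𝟙-does-mono : {A B : Set} → (A → B) → (a? : Dec A) (b? : Dec B) → 𝟙 (does a?) ≤ 𝟙 (does b?)
𝟙-does-mono A→B (yes a) (no ¬b) = contradiction (A→B a) ¬b
𝟙-does-mono _   (yes _) (yes _) = ℕ.≤-refl
𝟙-does-mono _   (no _)  _       = z≤n

below-mono : ∀ V {x y : Fin n} → x Fin.≤ y → below V x ≤ below V y
below-mono []      x≤y = z≤n
below-mono (v ∷ V) {x} {y} x≤y =
  ℕ.+-mono-≤ (𝟙-does-mono (λ v<x → ℕ.<-≤-trans v<x x≤y) (v Fin.<? x) (v Fin.<? y)) (below-mono V x≤y)

below-strict : ∀ {V} {x y : Fin n} → x ∈ V → x Fin.< y → below V x < below V y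
below-strict {V = v ∷ V} (here refl) x<y
  rewrite dec-false (v Fin.<? v) (Fin.<-irrefl refl) | dec-true (v Fin.<? _) x<y =
  s≤s (below-mono V (ℕ.<⇒≤ x<y))
below-strict {V = v ∷ V} {x} {y} (there x∈) x<y =
  ℕ.+-mono-≤-< (𝟙-does-mono (λ v<x → ℕ.<-trans v<x x<y) (v Fin.<? x) (v Fin.<? y)) (below-strict x∈ x<y)

𝟙≤1 : ∀ b → 𝟙 b ≤ 1
𝟙≤1 true  = ℕ.≤-refl
𝟙≤1 false = z≤n

below-≤-length : ∀ V (x : Fin n) → below V x ≤ length V
below-≤-length []      x = z≤n
below-≤-length (v ∷ V) x = ℕ.+-mono-≤ (𝟙≤1 _) (below-≤-length V x)

below-<-length : ∀ {V} {x : Fin n} → x ∈ V → below V x < length V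
below-<-length {V = v ∷ V} (here refl) rewrite dec-false (v Fin.<? v) (Fin.<-irrefl refl) =
  s≤s (below-≤-length V v)
below-<-length {V = v ∷ V} (there x∈) = ℕ.+-mono-≤-< (𝟙≤1 _) (below-<-length x∈)

module Rank (V : List (Fin n)) .{{_ : NonZero (length V)}} where

  -- Outside V the count is reduced modulo |V|; only points of V are ever ranked.
  rank : Fin n → Fin (length V)
  rank x = below V x mod length V

  toℕ-rank : ∀ {x} → x ∈ V → toℕ (rank x) ≡ below V x
  toℕ-rank x∈ = trans (Fin.toℕ-fromℕ< _) (m<n⇒m%n≡m (below-<-length x∈))

  rank-embedding : ∀ {u v} → u ∈ V → v ∈ V → u Fin.< v ⇔ rank u Fin.< rank v
  rank-embedding u∈ v∈ = mk⇔
    (λ u<v → subst₂ _<_ (sym (toℕ-rank u∈)) (sym (toℕ-rank v∈)) (below-strict u∈ u<v))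
    (λ ru<rv → ℕ.≰⇒> λ v≤u →
      ℕ.<⇒≱ ru<rv (subst₂ _≤_ (sym (toℕ-rank v∈)) (sym (toℕ-rank u∈)) (below-mono V v≤u)))

  χ-rank : ∀ {p p' q q'} → p ∈ V → p' ∈ V → q ∈ V → q' ∈ V →
           χ p p' q q' ≡ χ (rank p) (rank p') (rank q) (rank q')
  χ-rank p∈ p'∈ q∈ q'∈ = χ-resp-⇔ (cyclicOrder-map rank rank-embedding (p∈ ∷ q∈ ∷ p'∈ ∷ q'∈ ∷ []))

  cyclicOrder-rank : ∀ {xs} → All (_∈ V) xs → CyclicOrder xs → CyclicOrder (map rank xs)
  cyclicOrder-rank ∈V = Equivalence.to (cyclicOrder-map rank rank-embedding ∈V)

χ-sym-Fin4 : (p p' q q' : Fin 4) → χ p p' q q' ≡ χ q q' p p'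
χ-sym-Fin4 = from-yes (all? λ (p : Fin 4) → all? λ p' → all? λ q → all? λ q' →
  χ p p' q q' ℕ.≟ χ q q' p p')

nested-chords-Fin4 : (b c y z : Fin 4) → CyclicOrder (b ∷ c ∷ y ∷ z ∷ []) → χ b z c y ≡ 0
nested-chords-Fin4 = from-yes (all? λ (b : Fin 4) → all? λ c → all? λ y → all? λ z →
  cyclicOrder? (b ∷ c ∷ y ∷ z ∷ []) →-dec χ b z c y ℕ.≟ 0)

uncrossing-Fin6 : (b c y z : Fin 6) → CyclicOrder (b ∷ c ∷ y ∷ z ∷ []) →
                  (p q : Fin 6) → χ p q b z + χ p q c y ≤ χ p q b y + χ p q c z
uncrossing-Fin6 = from-yes (all? λ (b : Fin 6) → all? λ c → all? λ y → all? λ z →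
  cyclicOrder? (b ∷ c ∷ y ∷ z ∷ []) →-dec all? λ p → all? λ q →
  χ p q b z + χ p q c y ℕ.≤? χ p q b y + χ p q c z)

χ-sym : (p p' q q' : Fin n) → χ p p' q q' ≡ χ q q' p p'
χ-sym p p' q q' = begin
  χ p p' q q'                         ≡⟨ χ-rank p∈ p'∈ q∈ q'∈ ⟩
  χ (rank p) (rank p') (rank q) (rank q') ≡⟨ χ-sym-Fin4 (rank p) (rank p') (rank q) (rank q') ⟩
  χ (rank q) (rank q') (rank p) (rank p') ≡⟨ χ-rank q∈ q'∈ p∈ p'∈ ⟨
  χ q q' p p'                         ∎
  where
  open ≡-Reasoning
  open Rank (p ∷ p' ∷ q ∷ q' ∷ [])
  p∈ = here refl
  p'∈ = there (here refl)
  q∈ = there (there (here refl))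
  q'∈ = there (there (there (here refl)))

module _ {b c y z : Fin n} (order : CyclicOrder (b ∷ c ∷ y ∷ z ∷ [])) where

  nested-chords : χ b z c y ≡ 0
  nested-chords = begin
    χ b z c y                             ≡⟨ χ-rank b∈ z∈ c∈ y∈ ⟩
    χ (rank b) (rank z) (rank c) (rank y) ≡⟨ nested-chords-Fin4 (rank b) (rank c) (rank y) (rank z) order′ ⟩
    0                                     ∎
    where
    open ≡-Reasoning
    open Rank (b ∷ c ∷ y ∷ z ∷ [])
    b∈ = here refl
    c∈ = there (here refl)
    y∈ = there (there (here refl))
    z∈ = there (there (there (here refl)))
    order′ = cyclicOrder-rank (b∈ ∷ c∈ ∷ y∈ ∷ z∈ ∷ []) order

  crossing-chords : χ b y c z ≡ 1
  crossing-chords = Cross⇒χ≡1 order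

  uncrossing : (p q : Fin n) → χ p q b z + χ p q c y ≤ χ p q b y + χ p q c z
  uncrossing p q =
    subst₂ _≤_ (sym (cong₂ _+_ (χ-rank p∈ q∈ b∈ z∈) (χ-rank p∈ q∈ c∈ y∈)))
               (sym (cong₂ _+_ (χ-rank p∈ q∈ b∈ y∈) (χ-rank p∈ q∈ c∈ z∈)))
               (uncrossing-Fin6 (rank b) (rank c) (rank y) (rank z) order′ (rank p) (rank q))
    where
    open Rank (b ∷ c ∷ y ∷ z ∷ p ∷ q ∷ [])
    b∈ = here refl
    c∈ = there (here refl)
    y∈ = there (there (here refl))
    z∈ = there (there (there (here refl)))
    p∈ = there (there (there (there (here refl))))
    q∈ = there (there (there (there (there (here refl)))))
    order′ = cyclicOrder-rank (b∈ ∷ c∈ ∷ y∈ ∷ z∈ ∷ []) order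

  uncrossing′ : (p q : Fin n) → χ b z p q + χ c y p q ≤ χ b y p q + χ c z p q
  uncrossing′ p q = subst₂ _≤_ (cong₂ _+_ (χ-sym p q b z) (χ-sym p q c y))
                               (cong₂ _+_ (χ-sym p q b y) (χ-sym p q c z))
                               (uncrossing p q)

χ-diag : (p q : Fin n) → χ p q p q ≡ 0
χ-diag p q = ¬Cross⇒χ≡0 λ ppqq →
  cyclicOrder⇒≢ (cyclicOrder-⊆ (refl ∷ refl ∷ q ∷ʳ q ∷ʳ []) (λ ()) ppqq) refl

-- Counting crossings with a bilinear form

countFin≡sum : (f : Fin n → ℕ) → countFin f ≡ sum f
countFin≡sum {n} f = trans (cong sumₗ (map-tabulate (λ i → i) f)) (sum-tabulate n f)
  where
  sum-tabulate : ∀ n (f : Fin n → ℕ) → sumₗ (tabulate f) ≡ sum f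
  sum-tabulate zero    f = refl
  sum-tabulate (suc n) f = cong (f Fin.zero +_) (sum-tabulate n (f ∘ Fin.suc))

sum-mono : {f g : Fin n → ℕ} → (∀ i → f i ≤ g i) → sum f ≤ sum g
sum-mono {zero}  f≤g = z≤n
sum-mono {suc n} f≤g = ℕ.+-mono-≤ (f≤g Fin.zero) (sum-mono (f≤g ∘ Fin.suc))

sum-zero : {f : Fin n → ℕ} → (∀ i → f i ≡ 0) → sum f ≡ 0
sum-zero {n} f≡0 = trans (sum-cong-≗ f≡0) (sum-replicate-zero n)

sum-point : {f : Fin n → ℕ} (i : Fin n) → (∀ j → j ≢ i → f j ≡ 0) → sum f ≡ f i
sum-point {suc n} {f} i f≡0 = begin
  sum f                                 ≡⟨ sum-remove f ⟩
  f i + sum (λ j → f (Fin.punchIn i j)) ≡⟨ cong (f i +_) (sum-zero λ j → f≡0 _ (Fin.punchInᵢ≢i i j)) ⟩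
  f i + 0                               ≡⟨ ℕ.+-identityʳ (f i) ⟩
  f i                                   ∎
  where open ≡-Reasoning

Σ² : (Fin n → Fin n → ℕ) → ℕ
Σ² f = sum λ p → sum λ q → f p q

countFin²≡Σ² : (f : Fin n → Fin n → ℕ) → countFin (λ p → countFin (f p)) ≡ Σ² f
countFin²≡Σ² f = trans (countFin≡sum λ p → countFin (f p)) (sum-cong-≗ λ p → countFin≡sum (f p))

Σ²-cong : {f g : Fin n → Fin n → ℕ} → (∀ p q → f p q ≡ g p q) → Σ² f ≡ Σ² g
Σ²-cong f≡g = sum-cong-≗ λ p → sum-cong-≗ (f≡g p)

Σ²-mono : {f g : Fin n → Fin n → ℕ} → (∀ p q → f p q ≤ g p q) → Σ² f ≤ Σ² g
Σ²-mono f≤g = sum-mono λ p → sum-mono (f≤g p)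

Σ²-distrib-+ : (f g : Fin n → Fin n → ℕ) → Σ² (λ p q → f p q + g p q) ≡ Σ² f + Σ² g
Σ²-distrib-+ f g =
  trans (sum-cong-≗ λ p → ∑-distrib-+ (f p) (g p)) (∑-distrib-+ (λ p → sum (f p)) (λ p → sum (g p)))

Σ²-point : {f : Fin n → Fin n → ℕ} (u v : Fin n) →
           (∀ p q → ¬ (p ≡ u × q ≡ v) → f p q ≡ 0) → Σ² f ≡ f u v
Σ²-point u v f≡0 = trans (sum-point u λ p p≢u → sum-zero λ q → f≡0 p q (p≢u ∘ proj₁))
                         (sum-point v λ q q≢v → f≡0 u q (q≢v ∘ proj₂))

Σ²-*ˡ : (k : ℕ) (f : Fin n → Fin n → ℕ) → k * Σ² f ≡ Σ² λ p q → k * f p q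
Σ²-*ˡ k f = trans (*-distribˡ-sum k (λ p → sum (f p))) (sum-cong-≗ λ p → *-distribˡ-sum k (f p))

Weight : ℕ → Set
Weight n = Fin n → Fin n → ℕ

weight : Rel₂ n → Weight n
weight R p q = 𝟙 (R p q)

δ : Fin n → Fin n → Weight n
δ u v = weight (isPair u v)

_⊕_ : Weight n → Weight n → Weight n
(X ⊕ Y) p q = X p q + Y p q

_≤ʷ_ : Weight n → Weight n → Set
X ≤ʷ Y = ∀ p q → X p q ≤ Y p q

δ-outside : (u v : Fin n) {p q : Fin n} → ¬ (p ≡ u × q ≡ v) → δ u v p q ≡ 0
δ-outside u v {p} {q} ¬uv with isPair u v p q | isPair-reflects u v p q
... | true  | ofʸ uv = contradiction uv ¬uv
... | false | _      = refl

δ-at : (u v : Fin n) → δ u v u v ≡ 1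
δ-at u v with isPair u v u v | isPair-reflects u v u v
... | true  | _      = refl
... | false | ofⁿ ¬uv = contradiction (refl , refl) ¬uv

crossDegree : Weight n → Fin n → Fin n → ℕ
crossDegree Y p p' = Σ² λ q q' → Y q q' * χ p p' q q'

crossingForm : Weight n → Weight n → ℕ
crossingForm X Y = Σ² λ p p' → X p p' * crossDegree Y p p'

orderedCrossings≡crossingForm : (R : Rel₂ n) → orderedCrossings R ≡ crossingForm (weight R) (weight R)
orderedCrossings≡crossingForm R = begin
  orderedCrossings R
    ≡⟨ countFin²≡Σ² (λ p p' → countFin λ q → countFin (summand p p' q)) ⟩
  Σ² (λ p p' → countFin λ q → countFin (summand p p' q))
    ≡⟨ Σ²-cong (λ p p' → countFin²≡Σ² (summand p p')) ⟩
  Σ² (λ p p' → Σ² (summand p p'))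
    ≡⟨ Σ²-cong factor ⟩
  crossingForm (weight R) (weight R)
    ∎
  where
  open ≡-Reasoning
  summand : (p p' q q' : Fin _) → ℕ
  summand p p' q q' = 𝟙 (R p p' ∧ R q q' ∧ isYes (cross? p p' q q'))
  𝟙-∧∧ : ∀ a b c → 𝟙 (a ∧ b ∧ c) ≡ 𝟙 a * (𝟙 b * 𝟙 c)
  𝟙-∧∧ true  true  c = sym (trans (ℕ.*-identityˡ (1 * 𝟙 c)) (ℕ.*-identityˡ (𝟙 c)))
  𝟙-∧∧ true  false c = refl
  𝟙-∧∧ false b     c = refl
  factor : ∀ p p' → Σ² (summand p p') ≡ weight R p p' * crossDegree (weight R) p p'
  factor p p' = trans (Σ²-cong λ q q' → 𝟙-∧∧ (R p p') (R q q') (isYes (cross? p p' q q')))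
                      (sym (Σ²-*ˡ (weight R p p') λ q q' → weight R q q' * χ p p' q q'))

crossDegree-mono : {Y Y' : Weight n} → Y ≤ʷ Y' → ∀ p p' → crossDegree Y p p' ≤ crossDegree Y' p p'
crossDegree-mono Y≤Y' p p' = Σ²-mono λ q q' → ℕ.*-monoˡ-≤ (χ p p' q q') (Y≤Y' q q')

crossingForm-mono : {X X' Y Y' : Weight n} → X ≤ʷ X' → (∀ p p' → crossDegree Y p p' ≤ crossDegree Y' p p') →
                    crossingForm X Y ≤ crossingForm X' Y'
crossingForm-mono X≤X' deg≤ = Σ²-mono λ p p' → ℕ.*-mono-≤ (X≤X' p p') (deg≤ p p')

crossDegree-⊕ : (Y Y' : Weight n) (p p' : Fin n) →
                crossDegree (Y ⊕ Y') p p' ≡ crossDegree Y p p' + crossDegree Y' p p'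
crossDegree-⊕ Y Y' p p' =
  trans (Σ²-cong λ q q' → ℕ.*-distribʳ-+ (χ p p' q q') (Y q q') (Y' q q'))
        (Σ²-distrib-+ (λ q q' → Y q q' * χ p p' q q') (λ q q' → Y' q q' * χ p p' q q'))

crossingForm-⊕ˡ : (X X' Y : Weight n) → crossingForm (X ⊕ X') Y ≡ crossingForm X Y + crossingForm X' Y
crossingForm-⊕ˡ X X' Y =
  trans (Σ²-cong λ p p' → ℕ.*-distribʳ-+ (crossDegree Y p p') (X p p') (X' p p'))
        (Σ²-distrib-+ (λ p p' → X p p' * crossDegree Y p p') (λ p p' → X' p p' * crossDegree Y p p'))

crossingForm-⊕ʳ : (X Y Y' : Weight n) → crossingForm X (Y ⊕ Y') ≡ crossingForm X Y + crossingForm X Y'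
crossingForm-⊕ʳ X Y Y' =
  trans (Σ²-cong λ p p' → trans (cong (X p p' *_) (crossDegree-⊕ Y Y' p p'))
                                (ℕ.*-distribˡ-+ (X p p') (crossDegree Y p p') (crossDegree Y' p p')))
        (Σ²-distrib-+ (λ p p' → X p p' * crossDegree Y p p') (λ p p' → X p p' * crossDegree Y' p p'))

crossingForm-⊕² : (X Y : Weight n) → crossingForm (X ⊕ Y) (X ⊕ Y) ≡
                  (crossingForm X X + crossingForm X Y) + (crossingForm Y X + crossingForm Y Y)
crossingForm-⊕² X Y =
  trans (crossingForm-⊕ˡ X Y (X ⊕ Y)) (cong₂ _+_ (crossingForm-⊕ʳ X X Y) (crossingForm-⊕ʳ Y X Y))

crossDegree-δ : (u v p p' : Fin n) → crossDegree (δ u v) p p' ≡ χ p p' u v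
crossDegree-δ u v p p' = begin
  crossDegree (δ u v) p p' ≡⟨ Σ²-point u v (λ q q' ¬uv → cong (_* χ p p' q q') (δ-outside u v ¬uv)) ⟩
  δ u v u v * χ p p' u v   ≡⟨ cong (_* χ p p' u v) (δ-at u v) ⟩
  1 * χ p p' u v           ≡⟨ ℕ.*-identityˡ (χ p p' u v) ⟩
  χ p p' u v               ∎
  where open ≡-Reasoning

crossingForm-δˡ : (u v : Fin n) (Y : Weight n) → crossingForm (δ u v) Y ≡ crossDegree Y u v
crossingForm-δˡ u v Y = begin
  crossingForm (δ u v) Y        ≡⟨ Σ²-point u v (λ p p' ¬uv → cong (_* crossDegree Y p p') (δ-outside u v ¬uv)) ⟩
  δ u v u v * crossDegree Y u v ≡⟨ cong (_* crossDegree Y u v) (δ-at u v) ⟩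
  1 * crossDegree Y u v         ≡⟨ ℕ.*-identityˡ (crossDegree Y u v) ⟩
  crossDegree Y u v             ∎
  where open ≡-Reasoning

crossDegree-δ⊕δ : (s t s' t' p p' : Fin n) →
                  crossDegree (δ s t ⊕ δ s' t') p p' ≡ χ p p' s t + χ p p' s' t'
crossDegree-δ⊕δ s t s' t' p p' =
  trans (crossDegree-⊕ (δ s t) (δ s' t') p p') (cong₂ _+_ (crossDegree-δ s t p p') (crossDegree-δ s' t' p p'))

crossingForm-δ⊕δˡ : (u v u' v' : Fin n) (Y : Weight n) →
                    crossingForm (δ u v ⊕ δ u' v') Y ≡ crossDegree Y u v + crossDegree Y u' v'
crossingForm-δ⊕δˡ u v u' v' Y =
  trans (crossingForm-⊕ˡ (δ u v) (δ u' v') Y) (cong₂ _+_ (crossingForm-δˡ u v Y) (crossingForm-δˡ u' v' Y))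

crossingForm-δ⊕δ : (u v u' v' s t s' t' : Fin n) → crossingForm (δ u v ⊕ δ u' v') (δ s t ⊕ δ s' t') ≡
                   (χ u v s t + χ u v s' t') + (χ u' v' s t + χ u' v' s' t')
crossingForm-δ⊕δ u v u' v' s t s' t' =
  trans (crossingForm-δ⊕δˡ u v u' v' (δ s t ⊕ δ s' t'))
        (cong₂ _+_ (crossDegree-δ⊕δ s t s' t' u v) (crossDegree-δ⊕δ s t s' t' u' v'))

𝟙-∨ : ∀ a b → 𝟙 (a ∨ b) ≤ 𝟙 a + 𝟙 b
𝟙-∨ true  _ = s≤s z≤n
𝟙-∨ false _ = ℕ.≤-refl

m+2≤n⇒m/2<n/2 : ∀ {m n} → m + 2 ≤ n → m / 2 < n / 2
m+2≤n⇒m/2<n/2 {m} {n} m+2≤n = begin-strict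
  m / 2           <⟨ ℕ.m<m+n (m / 2) (s≤s z≤n) ⟩
  m / 2 + 1       ≡⟨ +-distrib-/-∣ʳ m ∣-refl ⟨
  (m + 2) / 2     ≤⟨ /-monoˡ-≤ 2 m+2≤n ⟩
  n / 2           ∎
  where open ℕ.≤-Reasoning

module _ (R : Rel₂ n) {b c y z : Fin n} (order : CyclicOrder (b ∷ c ∷ y ∷ z ∷ []))
         (Rby : R b y ≡ true) (Rcz : R c z ≡ true) where

  private
    R' : Rel₂ n
    R' = swapPairs R b c y z

    kept old new : Weight n
    kept p q = 𝟙 (R p q ∧ not (isPair b y p q) ∧ not (isPair c z p q))
    old = δ b y ⊕ δ c z
    new = δ b z ⊕ δ c y

    b≢c : b ≢ c
    b≢c = cyclicOrder⇒≢ (cyclicOrder-⊆ (refl ∷ refl ∷ y ∷ʳ z ∷ʳ []) (λ ()) order)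

  weight-swapPairs≤ : weight R' ≤ʷ (kept ⊕ new)
  weight-swapPairs≤ p q =
    ℕ.≤-trans (𝟙-∨ (R p q ∧ _) _) (ℕ.+-monoʳ-≤ (kept p q) (𝟙-∨ (isPair b z p q) (isPair c y p q)))

  kept⊕old≤weight : (kept ⊕ old) ≤ʷ weight R
  kept⊕old≤weight p q with isPair b y p q | isPair-reflects b y p q | isPair c z p q | isPair-reflects c z p q
  ... | true  | ofʸ (refl , refl) | true  | ofʸ (b≡c , _) = contradiction b≡c b≢c
  ... | true  | ofʸ (refl , refl) | false | _ rewrite Rby = ℕ.≤-refl
  ... | false | _ | true  | ofʸ (refl , refl) rewrite Rcz = ℕ.≤-refl
  ... | false | _ | false | _ with R p q
  ...   | true  = ℕ.≤-refl
  ...   | false = z≤n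

  crossDegree-new≤old : ∀ p p' → crossDegree new p p' ≤ crossDegree old p p'
  crossDegree-new≤old p p' =
    subst₂ _≤_ (sym (crossDegree-δ⊕δ b z c y p p')) (sym (crossDegree-δ⊕δ b y c z p p')) (uncrossing order p p')

  crossDegree-uncrossing : (Y : Weight n) →
                           crossDegree Y b z + crossDegree Y c y ≤ crossDegree Y b y + crossDegree Y c z
  crossDegree-uncrossing Y =
    subst₂ _≤_ (Σ²-distrib-+ (term b z) (term c y)) (Σ²-distrib-+ (term b y) (term c z)) (Σ²-mono λ q q' →
      subst₂ _≤_ (ℕ.*-distribˡ-+ (Y q q') (χ b z q q') (χ c y q q'))
                 (ℕ.*-distribˡ-+ (Y q q') (χ b y q q') (χ c z q q'))
                 (ℕ.*-monoʳ-≤ (Y q q') (uncrossing′ order q q')))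
    where
    term : Fin n → Fin n → Weight n
    term s t q q' = Y q q' * χ s t q q'

  crossingForm-new≤old : crossingForm new kept ≤ crossingForm old kept
  crossingForm-new≤old =
    subst₂ _≤_ (sym (crossingForm-δ⊕δˡ b z c y kept)) (sym (crossingForm-δ⊕δˡ b y c z kept))
               (crossDegree-uncrossing kept)

  crossingForm-new² : crossingForm new new ≡ 0
  crossingForm-new² = trans (crossingForm-δ⊕δ b z c y b z c y)
    (cong₂ _+_ (cong₂ _+_ (χ-diag b z) (nested-chords order))
               (cong₂ _+_ (trans (χ-sym c y b z) (nested-chords order)) (χ-diag c y)))

  crossingForm-old²≥2 : 2 ≤ crossingForm old old
  crossingForm-old²≥2 = begin
    2
      ≡⟨ cong₂ _+_ (crossing-chords order) (trans (χ-sym c z b y) (crossing-chords order)) ⟨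
    χ b y c z + χ c z b y
      ≤⟨ ℕ.+-mono-≤ (ℕ.m≤n+m _ (χ b y b y)) (ℕ.m≤m+n _ (χ c z c z)) ⟩
    (χ b y b y + χ b y c z) + (χ c z b y + χ c z c z)
      ≡⟨ crossingForm-δ⊕δ b y c z b y c z ⟨
    crossingForm old old
      ∎
    where open ℕ.≤-Reasoning

  orderedCrossings-swapPairs : orderedCrossings (swapPairs R b c y z) + 2 ≤ orderedCrossings R
  orderedCrossings-swapPairs = begin
    orderedCrossings R' + 2
      ≡⟨ cong (_+ 2) (orderedCrossings≡crossingForm R') ⟩
    F (weight R') (weight R') + 2
      ≤⟨ ℕ.+-monoˡ-≤ 2 upper ⟩
    F (kept ⊕ new) (kept ⊕ new) + 2
      ≡⟨ cong (_+ 2) (crossingForm-⊕² kept new) ⟩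
    (F kept kept + F kept new) + (F new kept + F new new) + 2
      ≡⟨ ℕ.+-assoc (F kept kept + F kept new) _ 2 ⟩
    (F kept kept + F kept new) + (F new kept + F new new + 2)
      ≡⟨ cong (F kept kept + F kept new +_) (ℕ.+-assoc (F new kept) _ 2) ⟩
    (F kept kept + F kept new) + (F new kept + (F new new + 2))
      ≤⟨ ℕ.+-mono-≤ (ℕ.+-monoʳ-≤ (F kept kept) kept-new≤old) (ℕ.+-mono-≤ crossingForm-new≤old new²+2≤old²) ⟩
    (F kept kept + F kept old) + (F old kept + F old old)
      ≡⟨ crossingForm-⊕² kept old ⟨
    F (kept ⊕ old) (kept ⊕ old)
      ≤⟨ lower ⟩
    F (weight R) (weight R)
      ≡⟨ orderedCrossings≡crossingForm R ⟨
    orderedCrossings R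
      ∎
    where
    open ℕ.≤-Reasoning
    F = crossingForm
    upper : F (weight R') (weight R') ≤ F (kept ⊕ new) (kept ⊕ new)
    upper = crossingForm-mono {Y = weight R'} {Y' = kept ⊕ new}
                              weight-swapPairs≤ (crossDegree-mono weight-swapPairs≤)
    lower : F (kept ⊕ old) (kept ⊕ old) ≤ F (weight R) (weight R)
    lower = crossingForm-mono {Y = kept ⊕ old} {Y' = weight R}
                              kept⊕old≤weight (crossDegree-mono kept⊕old≤weight)
    kept-new≤old : F kept new ≤ F kept old
    kept-new≤old = crossingForm-mono {X = kept} {Y = new} {Y' = old} (λ _ _ → ℕ.≤-refl) crossDegree-new≤old
    new²+2≤old² : F new new + 2 ≤ F old old
    new²+2≤old² = subst (λ t → t + 2 ≤ F old old) (sym crossingForm-new²) crossingForm-old²≥2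

  swapPairs-crossings< : crossings (swapPairs R b c y z) < crossings R
  swapPairs-crossings< = m+2≤n⇒m/2<n/2 orderedCrossings-swapPairs

lemma9 : (n : ℕ) (R : Rel₂ n) (a b c d x y z u : Fin n) →
    CyclicOrder (a ∷ b ∷ c ∷ d ∷ x ∷ y ∷ z ∷ u ∷ []) →
    R a x ≡ true → R b y ≡ true → R c z ≡ true → R d u ≡ true →
    ((s t : Fin n) → Gen (swapPairs R b c y z) s t ⇔ Gen R s t)
    × crossings (swapPairs R b c y z) < crossings R
lemma9 n R a b c d x y z u order Rax Rby Rcz Rdu =
  swapPairs-gen⇔ R order Rax Rby Rcz Rdu , swapPairs-crossings< R bcyz Rby Rcz
  where
  bcyz : CyclicOrder (b ∷ c ∷ y ∷ z ∷ [])
  bcyz = cyclicOrder-⊆ (a ∷ʳ refl ∷ refl ∷ d ∷ʳ x ∷ʳ refl ∷ refl ∷ u ∷ʳ []) (λ ()) order
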